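{- Let $f\in\mathbb{K}(x)$, $\lambda\in\mathbb{Z}$, and let $\tau\in\mathrm{supp}(f)\cap\mathcal{T}_+$. If $\mathrm{ht}(f,\tau)=0$, then $f_\tau$ is not $\lambda$-Mahler summable.
   Context: $\mathbb{K}$ is an algebraically closed field of characteristic zero, $p\ge2$ a fixed integer, $\sigma(f(x))=f(x^p)$, $\Delta_\lambda:=p^\lambda\sigma-\mathrm{id}$; $f$ is $\lambda$-Mahler summable if $f=\Delta_\lambda(g)$ for some $g\in\mathbb{K}(x)$. Mahler trees are the classes of $\mathbb{K}^\times$ under $\alpha\sim\gamma\iff\alpha^{p^r}=\gamma^{p^s}$ ($r,s\ge0$). For a tree $\tau$, $\mathcal{C}(\tau)$ is the set of elements of $\tau$ that are roots of unity of order coprime to $p$; $\mathcal{T}_+$ is the set of trees with $\mathcal{C}(\tau)\ne\emptyset$. Write $f=f_\infty+f_{\mathcal{T}}$ with $f_\infty\in\mathbb{K}[x,x^{ -1}]$ and $f_{\mathcal{T}}$ a proper fraction with no pole at $0$; $f_\tau$ is the sum of the terms of the partial fraction decomposition of $f_{\mathcal{T}}$ with poles in $\tau$. $\tau\in\mathrm{supp}(f)$ means that $\tau$ contains a pole of $f$. For $\tau\in\mathcal{T}_+$ and $\alpha\in\tau$, the height $\eta(\alpha)$ is the smallest $n\ge0$ with $\alpha^{p^n}\in\mathcal{C}(\tau)$, and $\mathrm{ht}(f,\tau):=\max\{\eta(\alpha):\alpha\text{ a pole of }f\text{ in }\tau\}$. -}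

module Defs where

open import Level using (Level; _⊔_)
open import Algebra.Bundles using (CommutativeRing)
open import Data.Nat as ℕ using (ℕ; zero; suc; _≤_; _<_)
open import Data.Nat.Coprimality using (Coprime)
open import Data.Integer using (ℤ; +_; -[1+_])
open import Data.List using (List; []; _∷_; replicate; _++_)
open import Data.Product using (Σ; ∃; ∃-syntax; _×_; _,_)
open import Relation.Nullary using (¬_)

module RingOps {c ℓ : Level} (R : CommutativeRing c ℓ) where
  open CommutativeRing R
  pow : Carrier → ℕ → Carrier
  pow x zero = 1#
  pow x (suc n) = x * pow x n
  nat : ℕ → Carrier
  nat zero = 0#
  nat (suc n) = 1# + nat n

-- Polynomials over a ring as coefficient lists (constant term first).
-- Trailing zeros are allowed; equality is coefficientwise (see _≋_).
module PolyOps {c ℓ : Level} (R : CommutativeRing c ℓ) where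
  open CommutativeRing R
  open RingOps R

  Poly : Set c
  Poly = List Carrier

  coeff : Poly → ℕ → Carrier
  coeff [] n = 0#
  coeff (a ∷ as) zero = a
  coeff (a ∷ as) (suc n) = coeff as n

  _≋_ : Poly → Poly → Set ℓ
  P ≋ Q = ∀ n → coeff P n ≈ coeff Q n

  NonZeroPoly : Poly → Set ℓ
  NonZeroPoly P = ¬ (∀ n → coeff P n ≈ 0#)

  eval : Poly → Carrier → Carrier
  eval [] x = 0#
  eval (a ∷ as) x = a + x * eval as x

  _+ₚ_ : Poly → Poly → Poly
  [] +ₚ Q = Q
  (a ∷ as) +ₚ [] = a ∷ as
  (a ∷ as) +ₚ (b ∷ bs) = (a + b) ∷ (as +ₚ bs)

  scale : Carrier → Poly → Poly
  scale k [] = []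
  scale k (a ∷ as) = (k * a) ∷ scale k as

  negₚ : Poly → Poly
  negₚ = scale (- 1#)

  _*ₚ_ : Poly → Poly → Poly
  [] *ₚ Q = []
  (a ∷ as) *ₚ Q = scale a Q +ₚ (0# ∷ (as *ₚ Q))

  -- substitution x ↦ x^p  (for p ≥ 1)
  subst-pow : ℕ → Poly → Poly
  subst-pow p [] = []
  subst-pow p (a ∷ as) = a ∷ (replicate (p ℕ.∸ 1) 0# ++ subst-pow p as)

record ACField (c ℓ : Level) : Set (Level.suc (c ⊔ ℓ)) where
  field
    commRing : CommutativeRing c ℓ
  open CommutativeRing commRing public
  open RingOps commRing public
  open PolyOps commRing public
  field
    0≉1 : ¬ (0# ≈ 1#)
    inverse : ∀ x → ¬ (x ≈ 0#) → ∃[ y ] (x * y ≈ 1#)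
    char0 : ∀ n → ¬ (nat (suc n) ≈ 0#)
    algClosed : ∀ (P : Poly) → (∃[ d ] (1 ≤ d × ¬ (coeff P d ≈ 0#))) →
                ∃[ x ] (eval P x ≈ 0#)

module Theory {c ℓ : Level} (K : ACField c ℓ) (p : ℕ) where
  open ACField K

  record RatFun : Set c where
    constructor _/_
    field
      num : Poly
      den : Poly
  open RatFun public

  _≃_ : RatFun → RatFun → Set ℓ
  f ≃ g = (num f *ₚ den g) ≋ (num g *ₚ den f)

  _−ᵣ_ : RatFun → RatFun → RatFun
  f −ᵣ g = ((num f *ₚ den g) +ₚ negₚ (num g *ₚ den f)) / (den f *ₚ den g)

  scaleᵣ : Carrier → RatFun → RatFun
  scaleᵣ k f = scale k (num f) / den f

  σ : RatFun → RatFun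
  σ f = subst-pow p (num f) / subst-pow p (den f)

  IsPowλ : ℤ → Carrier → Set ℓ
  IsPowλ (+ n) s = s ≈ pow (nat p) n
  IsPowλ -[1+ n ] s = s * pow (nat p) (suc n) ≈ 1#

  -- Δ_λ(g) = p^λ σ(g) − g ;  f is λ-Mahler summable
  MahlerSummable : ℤ → RatFun → Set (c ⊔ ℓ)
  MahlerSummable λ' f =
    ∃[ s ] (IsPowλ λ' s × ∃[ g ] (NonZeroPoly (den g) × (f ≃ (scaleᵣ s (σ g) −ᵣ g))))

  IsPole : RatFun → Carrier → Set (c ⊔ ℓ)
  IsPole f α = ¬ (∃[ g ] (¬ (eval (den g) α ≈ 0#) × f ≃ g))

  -- proper fraction: deg num < deg den
  Proper : RatFun → Set ℓ
  Proper f = ∃[ d ] (¬ (coeff (den f) d ≈ 0#) × (∀ n → d ≤ n → coeff (num f) n ≈ 0#))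

  -- Mahler trees, represented by an element β ∈ K^×:  τ = class of β
  InTree : Carrier → Carrier → Set ℓ
  InTree β α = ¬ (α ≈ 0#) × ∃[ r ] ∃[ s ] (pow α (p ℕ.^ r) ≈ pow β (p ℕ.^ s))

  IsOrder : Carrier → ℕ → Set ℓ
  IsOrder ζ n = 1 ≤ n × pow ζ n ≈ 1# × (∀ m → 1 ≤ m → m < n → ¬ (pow ζ m ≈ 1#))

  RootOfUnityCoprime : Carrier → Set ℓ
  RootOfUnityCoprime ζ = ∃[ n ] (IsOrder ζ n × Coprime n p)

  InC : Carrier → Carrier → Set ℓ
  InC β α = InTree β α × RootOfUnityCoprime α

  InTPlus : Carrier → Set (c ⊔ ℓ)
  InTPlus β = ∃[ α ] InC β α

  InSupp : RatFun → Carrier → Set (c ⊔ ℓ)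
  InSupp f β = ∃[ α ] (InTree β α × IsPole f α)

  IsHeight : Carrier → Carrier → ℕ → Set ℓ
  IsHeight β α n = InC β (pow α (p ℕ.^ n)) × (∀ m → m < n → ¬ InC β (pow α (p ℕ.^ m)))

  HtZero : RatFun → Carrier → Set (c ⊔ ℓ)
  HtZero f β = ∀ α → InTree β α → IsPole f α → IsHeight β α 0

  -- h = f_τ : h is proper, all poles of h lie in τ, and f − h has no pole in τ
  -- (this characterizes the τ-component of the partial fraction decomposition uniquely)
  IsTauComponent : RatFun → Carrier → RatFun → Set (c ⊔ ℓ)
  IsTauComponent f β h =
    NonZeroPoly (den h) × Proper h ×
    (∀ α → IsPole h α → InTree β α) ×
    (∀ α → InTree β α → ¬ IsPole (f −ᵣ h) α)

{-# OPTIONS --safe #-}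
-- Suppose f_τ = s σ(a/b) - a/b with s = p^λ ≠ 0, where (by induction on the length of b) a and b
-- have no common root. Since f - f_τ is regular on τ, f_τ has a pole in τ, and every pole of f_τ
-- in τ is a pole of f, so has height 0: it is a root of unity of order prime to p. At a pole α
-- of f_τ the representation cannot be regular, so b(α) = 0 or b(α^p) = 0. Given a root γ of b in
-- τ, some p-th root ω of γ is not a root of unity of order prime to p (two p-th roots differ by a
-- p-th root of unity ε ≠ 1, which would otherwise be one too, forcing ε = 1). If b(ω) ≠ 0, the
-- numerator s a(γ) b(ω) of the representation is nonzero at ω while its denominator b(γ) b(ω)
-- vanishes, making ω a pole of f_τ in τ of positive height; hence b(ω) = 0. Iterating yields more
-- distinct roots of b than its length allows: ω = ω^(p^j) would make ω a root of unity of order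
-- prime to p.
--
-- Equality in K is undecidable, so case distinctions are made under double negation, which is
-- enough for a negative conclusion.
module Submission where

open import Defs
open import Level using (Level; _⊔_)
open import Function using (_∘_)
open import Algebra.Bundles using (CommutativeRing)
import Algebra.Properties.Ring as RingProperties
import Algebra.Properties.Semiring.Mult as SemiringMult
open import Algebra.Solver.Ring.AlmostCommutativeRing using (fromCommutativeRing; _-Raw-AlmostCommutative⟶_)
import Algebra.Solver.Ring as RingSolver
open import Data.Empty using (⊥; ⊥-elim)
open import Data.Product using (∃; ∃-syntax; _×_; _,_; proj₁; proj₂)
open import Data.Sum using (_⊎_; inj₁; inj₂)
import Data.Sum as Sum
open import Data.Maybe using (Maybe)
import Data.Maybe as Maybe
open import Data.Sign as Sign using (Sign)
open import Data.Nat as ℕ using (ℕ; zero; suc; _≤_; _<_)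
import Data.Nat.Properties as ℕ
open import Data.Nat.Coprimality using (Coprime; coprime-Bézout; coprime-divisor)
open import Data.Nat.Divisibility using (_∣_; ∣-trans; m∣m*n; ∣m+n∣m⇒∣n; ∣1⇒≡1)
open import Data.Nat.GCD using (module Bézout)
open import Data.Nat.Induction using (<-wellFounded)
open import Data.Integer as ℤ using (ℤ; +_; -[1+_])
import Data.Integer.Properties as ℤ
open import Data.List using (List; []; _∷_; replicate; _++_; length; applyUpTo)
import Data.List.Properties as List
open import Data.List.Relation.Unary.All using (All; []; _∷_)
import Data.List.Relation.Unary.All as All
import Data.List.Relation.Unary.All.Properties as All
open import Data.List.Relation.Unary.AllPairs using (AllPairs; []; _∷_)
import Data.List.Relation.Unary.AllPairs.Properties as AllPairs
open import Induction.WellFounded using (Acc; acc)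
open import Relation.Nullary using (¬_)
open import Relation.Nullary.Decidable using (yes; no; ¬¬-excluded-middle; dec⇒maybe)
open import Relation.Nullary.Negation using (¬¬-map)
import Relation.Binary.PropositionalEquality as ≡

coprime-*ˡ : ∀ {m n k} → Coprime m k → Coprime n k → Coprime (m ℕ.* n) k
coprime-*ˡ {m} m⊥k n⊥k {d} (d∣mn , d∣k) = n⊥k (coprime-divisor d⊥m d∣mn , d∣k)
  where
  d⊥m : Coprime d m
  d⊥m (e∣d , e∣m) = m⊥k (e∣m , ∣-trans e∣d d∣k)

coprime-pred : ∀ {n m} → m ∣ suc n → Coprime n m
coprime-pred {n} m∣1+n {d} (d∣n , d∣m) =
  ∣1⇒≡1 (∣m+n∣m⇒∣n (≡.subst (d ∣_) (ℕ.+-comm 1 n) (∣-trans d∣m m∣1+n)) d∣n)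

-- The ring solver needs coefficients with decidable equality; those of R need not have it, so
-- the coefficients are taken in ℤ and mapped into R.
module IntegerSolver {c ℓ : Level} (R : CommutativeRing c ℓ) where
  open CommutativeRing R
  open RingProperties ring using (-‿distribˡ-*; -‿involutive; -‿+-comm; -0#≈0#)
  open SemiringMult semiring using (×-homo-+; ×1-homo-*) renaming (_×_ to _×ᵤ_)
  open import Algebra.Properties.CommutativeSemigroup *-commutativeSemigroup using (interchange)
  open import Relation.Binary.Reasoning.Setoid setoid

  fromℤ : ℤ → Carrier
  fromℤ (+ n) = n ×ᵤ 1#
  fromℤ -[1+ n ] = - (suc n ×ᵤ 1#)

  fromSign : Sign → Carrier
  fromSign Sign.+ = 1#
  fromSign Sign.- = - 1#

  x-0≈x : ∀ x → x + - 0# ≈ x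
  x-0≈x x = trans (+-congˡ -0#≈0#) (+-identityʳ x)

  ⊖-homo : ∀ m n → fromℤ (m ℤ.⊖ n) ≈ m ×ᵤ 1# + - (n ×ᵤ 1#)
  ⊖-homo zero zero = sym (x-0≈x 0#)
  ⊖-homo zero (suc n) = sym (+-identityˡ _)
  ⊖-homo (suc m) zero = sym (x-0≈x _)
  ⊖-homo (suc m) (suc n) = begin
    fromℤ (suc m ℤ.⊖ suc n)                  ≡⟨ ≡.cong fromℤ (ℤ.[1+m]⊖[1+n]≡m⊖n m n) ⟩
    fromℤ (m ℤ.⊖ n)                          ≈⟨ ⊖-homo m n ⟩
    m ×ᵤ 1# + - (n ×ᵤ 1#)                    ≈⟨ +-congˡ (trans (+-congʳ (-‿inverseʳ 1#)) (+-identityˡ _)) ⟨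
    m ×ᵤ 1# + ((1# + - 1#) + - (n ×ᵤ 1#))    ≈⟨ +-congˡ (+-assoc _ _ _) ⟩
    m ×ᵤ 1# + (1# + (- 1# + - (n ×ᵤ 1#)))    ≈⟨ +-assoc _ _ _ ⟨
    (m ×ᵤ 1# + 1#) + (- 1# + - (n ×ᵤ 1#))    ≈⟨ +-cong (+-comm _ _) (-‿+-comm _ _) ⟩
    suc m ×ᵤ 1# + - (suc n ×ᵤ 1#)            ∎

  ◃-homo : ∀ s n → fromℤ (s ℤ.◃ n) ≈ fromSign s * (n ×ᵤ 1#)
  ◃-homo s zero = sym (zeroʳ _)
  ◃-homo Sign.+ (suc n) = sym (*-identityˡ _)
  ◃-homo Sign.- (suc n) = trans (-‿cong (sym (*-identityˡ _))) (-‿distribˡ-* _ _)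

  fromℤ-sign◃abs : ∀ i → fromℤ i ≈ fromSign (ℤ.sign i) * (ℤ.∣ i ∣ ×ᵤ 1#)
  fromℤ-sign◃abs i =
    trans (reflexive (≡.cong fromℤ (≡.sym (ℤ.◃-inverse i)))) (◃-homo (ℤ.sign i) ℤ.∣ i ∣)

  sign-homo : ∀ s t → fromSign (s Sign.* t) ≈ fromSign s * fromSign t
  sign-homo Sign.+ t = sym (*-identityˡ _)
  sign-homo Sign.- Sign.+ = sym (*-identityʳ _)
  sign-homo Sign.- Sign.- = begin
    1#             ≈⟨ -‿involutive _ ⟨
    - - 1#         ≈⟨ -‿cong (*-identityˡ _) ⟨
    - (1# * - 1#)  ≈⟨ -‿distribˡ-* _ _ ⟩
    - 1# * - 1#    ∎

  +-homo : ∀ i j → fromℤ (i ℤ.+ j) ≈ fromℤ i + fromℤ j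
  +-homo (+ m) (+ n) = ×-homo-+ 1# m n
  +-homo (+ m) -[1+ n ] = ⊖-homo m (suc n)
  +-homo -[1+ m ] (+ n) = trans (⊖-homo n (suc m)) (+-comm _ _)
  +-homo -[1+ m ] -[1+ n ] = begin
    - (suc (suc (m ℕ.+ n)) ×ᵤ 1#)      ≡⟨ ≡.cong (λ k → - (suc k ×ᵤ 1#)) (ℕ.+-suc m n) ⟨
    - ((suc m ℕ.+ suc n) ×ᵤ 1#)        ≈⟨ -‿cong (×-homo-+ 1# (suc m) (suc n)) ⟩
    - (suc m ×ᵤ 1# + suc n ×ᵤ 1#)      ≈⟨ -‿+-comm _ _ ⟨
    - (suc m ×ᵤ 1#) + - (suc n ×ᵤ 1#)  ∎

  *-homo : ∀ i j → fromℤ (i ℤ.* j) ≈ fromℤ i * fromℤ j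
  *-homo i j = begin
    fromℤ (ℤ.sign i Sign.* ℤ.sign j ℤ.◃ ℤ.∣ i ∣ ℕ.* ℤ.∣ j ∣)
      ≈⟨ ◃-homo (ℤ.sign i Sign.* ℤ.sign j) (ℤ.∣ i ∣ ℕ.* ℤ.∣ j ∣) ⟩
    fromSign (ℤ.sign i Sign.* ℤ.sign j) * ((ℤ.∣ i ∣ ℕ.* ℤ.∣ j ∣) ×ᵤ 1#)
      ≈⟨ *-cong (sign-homo (ℤ.sign i) (ℤ.sign j)) (×1-homo-* ℤ.∣ i ∣ ℤ.∣ j ∣) ⟩
    (fromSign (ℤ.sign i) * fromSign (ℤ.sign j)) * (ℤ.∣ i ∣ ×ᵤ 1# * ℤ.∣ j ∣ ×ᵤ 1#)
      ≈⟨ interchange _ _ _ _ ⟩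
    (fromSign (ℤ.sign i) * ℤ.∣ i ∣ ×ᵤ 1#) * (fromSign (ℤ.sign j) * ℤ.∣ j ∣ ×ᵤ 1#)
      ≈⟨ *-cong (fromℤ-sign◃abs i) (fromℤ-sign◃abs j) ⟨
    fromℤ i * fromℤ j
      ∎

  neg-homo : ∀ i → fromℤ (ℤ.- i) ≈ - fromℤ i
  neg-homo (+ zero) = sym -0#≈0#
  neg-homo (+ suc n) = refl
  neg-homo -[1+ n ] = sym (-‿involutive _)

  homomorphism : ℤ.+-*-rawRing -Raw-AlmostCommutative⟶ fromCommutativeRing R
  homomorphism = record
    { ⟦_⟧ = fromℤ ; +-homo = +-homo ; *-homo = *-homo ; -‿homo = neg-homo
    ; 0-homo = refl ; 1-homo = +-identityʳ 1# }

  fromℤ-≟ : ∀ i j → Maybe (fromℤ i ≈ fromℤ j)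
  fromℤ-≟ i j = Maybe.map (λ { ≡.refl → refl }) (dec⇒maybe (i ℤ.≟ j))

  open RingSolver ℤ.+-*-rawRing (fromCommutativeRing R) homomorphism fromℤ-≟ public

module Powers {c ℓ : Level} (R : CommutativeRing c ℓ) where
  open CommutativeRing R
  open RingOps R
  open import Algebra.Properties.CommutativeSemiring.Exp commutativeSemiring
    using (_^_; ^-congˡ; ^-assocʳ; ^-distrib-*)
  open import Relation.Binary.Reasoning.Setoid setoid

  pow≡^ : ∀ x n → pow x n ≡.≡ x ^ n
  pow≡^ x zero = ≡.refl
  pow≡^ x (suc n) = ≡.cong (x *_) (pow≡^ x n)

  pow-congˡ : ∀ {x y} n → x ≈ y → pow x n ≈ pow y n
  pow-congˡ {x} {y} n x≈y rewrite pow≡^ x n | pow≡^ y n = ^-congˡ n x≈y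

  pow-* : ∀ x m n → pow x (m ℕ.* n) ≈ pow (pow x m) n
  pow-* x m n rewrite pow≡^ x (m ℕ.* n) | pow≡^ x m | pow≡^ (x ^ m) n = sym (^-assocʳ x m n)

  pow-distrib-* : ∀ x y n → pow (x * y) n ≈ pow x n * pow y n
  pow-distrib-* x y n rewrite pow≡^ (x * y) n | pow≡^ x n | pow≡^ y n = ^-distrib-* x y n

  pow-1# : ∀ n → pow 1# n ≈ 1#
  pow-1# zero = refl
  pow-1# (suc n) = trans (*-identityˡ _) (pow-1# n)

  pow≈1-multiple : ∀ {x} m k → pow x m ≈ 1# → pow x (k ℕ.* m) ≈ 1#
  pow≈1-multiple {x} m k xᵐ≈1 = begin
    pow x (k ℕ.* m)  ≡⟨ ≡.cong (pow x) (ℕ.*-comm k m) ⟩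
    pow x (m ℕ.* k)  ≈⟨ pow-* x m k ⟩
    pow (pow x m) k  ≈⟨ pow-congˡ k xᵐ≈1 ⟩
    pow 1# k         ≈⟨ pow-1# k ⟩
    1#               ∎

  pow≈1-coprime⇒≈1 : ∀ {x} m n → pow x m ≈ 1# → pow x n ≈ 1# → Coprime m n → x ≈ 1#
  pow≈1-coprime⇒≈1 {x} m n xᵐ≈1 xⁿ≈1 m⊥n with coprime-Bézout m⊥n
  ... | Bézout.+- i j 1+jn≡im = begin
    x                     ≈⟨ *-identityʳ x ⟨
    x * 1#                ≈⟨ *-congˡ (pow≈1-multiple n j xⁿ≈1) ⟨
    pow x (suc (j ℕ.* n)) ≡⟨ ≡.cong (pow x) 1+jn≡im ⟩
    pow x (i ℕ.* m)       ≈⟨ pow≈1-multiple m i xᵐ≈1 ⟩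
    1#                    ∎
  ... | Bézout.-+ i j 1+im≡jn = begin
    x                     ≈⟨ *-identityʳ x ⟨
    x * 1#                ≈⟨ *-congˡ (pow≈1-multiple m i xᵐ≈1) ⟨
    pow x (suc (i ℕ.* m)) ≡⟨ ≡.cong (pow x) 1+im≡jn ⟩
    pow x (j ℕ.* n)       ≈⟨ pow≈1-multiple n j xⁿ≈1 ⟩
    1#                    ∎

module Polynomials {c ℓ : Level} (R : CommutativeRing c ℓ) where
  open CommutativeRing R
  open RingOps R
  open PolyOps R
  open IntegerSolver R using (solve; _:=_; _:+_; _:*_; _:-_; con)
  open RingProperties ring using (-1*x≈-x; x∙y⁻¹≈ε⇒x≈y)
  open import Relation.Binary.Reasoning.Setoid setoid

  ZeroPoly : Poly → Set ℓ
  ZeroPoly P = ∀ n → coeff P n ≈ 0#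

  eval-+ₚ : ∀ P Q x → eval (P +ₚ Q) x ≈ eval P x + eval Q x
  eval-+ₚ [] Q x = sym (+-identityˡ _)
  eval-+ₚ (a ∷ as) [] x = sym (+-identityʳ _)
  eval-+ₚ (a ∷ as) (b ∷ bs) x = begin
    (a + b) + x * eval (as +ₚ bs) x
      ≈⟨ +-congˡ (*-congˡ (eval-+ₚ as bs x)) ⟩
    (a + b) + x * (eval as x + eval bs x)
      ≈⟨ solve 5 (λ a b x u v → (a :+ b) :+ x :* (u :+ v) := (a :+ x :* u) :+ (b :+ x :* v))
                 refl a b x _ _ ⟩
    (a + x * eval as x) + (b + x * eval bs x)
      ∎

  eval-scale : ∀ k P x → eval (scale k P) x ≈ k * eval P x
  eval-scale k [] x = sym (zeroʳ _)
  eval-scale k (a ∷ as) x = begin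
    k * a + x * eval (scale k as) x
      ≈⟨ +-congˡ (*-congˡ (eval-scale k as x)) ⟩
    k * a + x * (k * eval as x)
      ≈⟨ solve 4 (λ k a x u → k :* a :+ x :* (k :* u) := k :* (a :+ x :* u)) refl k a x _ ⟩
    k * (a + x * eval as x)
      ∎

  eval-negₚ : ∀ P x → eval (negₚ P) x ≈ - eval P x
  eval-negₚ P x = trans (eval-scale (- 1#) P x) (-1*x≈-x _)

  eval-*ₚ : ∀ P Q x → eval (P *ₚ Q) x ≈ eval P x * eval Q x
  eval-*ₚ [] Q x = sym (zeroˡ _)
  eval-*ₚ (a ∷ as) Q x = begin
    eval (scale a Q +ₚ (0# ∷ (as *ₚ Q))) x
      ≈⟨ eval-+ₚ (scale a Q) (0# ∷ (as *ₚ Q)) x ⟩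
    eval (scale a Q) x + (0# + x * eval (as *ₚ Q) x)
      ≈⟨ +-cong (eval-scale a Q x) (+-congˡ (*-congˡ (eval-*ₚ as Q x))) ⟩
    a * eval Q x + (0# + x * (eval as x * eval Q x))
      ≈⟨ solve 4 (λ a x u w → a :* w :+ (con (+ 0) :+ x :* (u :* w)) := (a :+ x :* u) :* w)
                 refl a x _ _ ⟩
    (a + x * eval as x) * eval Q x
      ∎

  eval-padding : ∀ k Q x → eval (replicate k 0# ++ Q) x ≈ pow x k * eval Q x
  eval-padding zero Q x = sym (*-identityˡ _)
  eval-padding (suc k) Q x = begin
    0# + x * eval (replicate k 0# ++ Q) x
      ≈⟨ +-congˡ (*-congˡ (eval-padding k Q x)) ⟩
    0# + x * (pow x k * eval Q x)
      ≈⟨ solve 3 (λ x a b → con (+ 0) :+ x :* (a :* b) := (x :* a) :* b) refl x _ _ ⟩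
    (x * pow x k) * eval Q x
      ∎

  eval-subst-pow : ∀ k P x → eval (subst-pow (suc k) P) x ≈ eval P (pow x (suc k))
  eval-subst-pow k [] x = refl
  eval-subst-pow k (a ∷ as) x = begin
    a + x * eval (replicate k 0# ++ subst-pow (suc k) as) x
      ≈⟨ +-congˡ (*-congˡ (eval-padding k (subst-pow (suc k) as) x)) ⟩
    a + x * (pow x k * eval (subst-pow (suc k) as) x)
      ≈⟨ +-congˡ (*-congˡ (*-congˡ (eval-subst-pow k as x))) ⟩
    a + x * (pow x k * eval as (pow x (suc k)))
      ≈⟨ +-congˡ (*-assoc _ _ _) ⟨
    a + pow x (suc k) * eval as (pow x (suc k))
      ∎

  eval-zeroPoly : ∀ P x → ZeroPoly P → eval P x ≈ 0#
  eval-zeroPoly [] x _ = refl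
  eval-zeroPoly (a ∷ as) x P≈0 = begin
    a + x * eval as x  ≈⟨ +-cong (P≈0 0) (*-congˡ (eval-zeroPoly as x (λ n → P≈0 (suc n)))) ⟩
    0# + x * 0#        ≈⟨ solve 1 (λ x → con (+ 0) :+ x :* con (+ 0) := con (+ 0)) refl x ⟩
    0#                 ∎

  eval-congˡ : ∀ P Q x → P ≋ Q → eval P x ≈ eval Q x
  eval-congˡ [] [] x _ = refl
  eval-congˡ [] (b ∷ bs) x P≋Q = sym (eval-zeroPoly (b ∷ bs) x (λ n → sym (P≋Q n)))
  eval-congˡ (a ∷ as) [] x P≋Q = eval-zeroPoly (a ∷ as) x P≋Q
  eval-congˡ (a ∷ as) (b ∷ bs) x P≋Q = +-cong (P≋Q 0) (*-congˡ (eval-congˡ as bs x (λ n → P≋Q (suc n))))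

  eval-congʳ : ∀ P {x y} → x ≈ y → eval P x ≈ eval P y
  eval-congʳ [] _ = refl
  eval-congʳ (a ∷ as) x≈y = +-congˡ (*-cong x≈y (eval-congʳ as x≈y))

  coeff-+ₚ : ∀ P Q n → coeff (P +ₚ Q) n ≈ coeff P n + coeff Q n
  coeff-+ₚ [] Q n = sym (+-identityˡ _)
  coeff-+ₚ (a ∷ as) [] n = sym (+-identityʳ _)
  coeff-+ₚ (a ∷ as) (b ∷ bs) zero = refl
  coeff-+ₚ (a ∷ as) (b ∷ bs) (suc n) = coeff-+ₚ as bs n

  coeff-scale : ∀ k P n → coeff (scale k P) n ≈ k * coeff P n
  coeff-scale k [] n = sym (zeroʳ _)
  coeff-scale k (a ∷ as) zero = refl
  coeff-scale k (a ∷ as) (suc n) = coeff-scale k as n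

  ≋-fromDifference : ∀ P Q → ZeroPoly (P +ₚ negₚ Q) → P ≋ Q
  ≋-fromDifference P Q P-Q≈0 n = x∙y⁻¹≈ε⇒x≈y _ _ (begin
    coeff P n + - coeff Q n             ≈⟨ +-congˡ (-1*x≈-x _) ⟨
    coeff P n + - 1# * coeff Q n        ≈⟨ +-congˡ (coeff-scale (- 1#) Q n) ⟨
    coeff P n + coeff (negₚ Q) n        ≈⟨ coeff-+ₚ P (negₚ Q) n ⟨
    coeff (P +ₚ negₚ Q) n               ≈⟨ P-Q≈0 n ⟩
    0#                                  ∎)

  coeff-padding : ∀ k Q m → coeff (replicate k 0# ++ Q) (k ℕ.+ m) ≡.≡ coeff Q m
  coeff-padding zero Q m = ≡.refl
  coeff-padding (suc k) Q m = coeff-padding k Q m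

  zeroPoly-subst-pow : ∀ k P → ZeroPoly (subst-pow (suc k) P) → ZeroPoly P
  zeroPoly-subst-pow k [] _ n = refl
  zeroPoly-subst-pow k (a ∷ as) σP≈0 zero = σP≈0 0
  zeroPoly-subst-pow k (a ∷ as) σP≈0 (suc n) = zeroPoly-subst-pow k as σas≈0 n
    where
    σas≈0 : ZeroPoly (subst-pow (suc k) as)
    σas≈0 m = ≡.subst (_≈ 0#) (coeff-padding k (subst-pow (suc k) as) m) (σP≈0 (suc (k ℕ.+ m)))

  geometric-sum : ∀ n x → (x + - 1#) * eval (replicate n 1#) x ≈ pow x n + - 1#
  geometric-sum zero x = solve 2 (λ x o → (x :- o) :* con (+ 0) := o :- o) refl x 1#
  geometric-sum (suc n) x = begin
    (x + - 1#) * (1# + x * eval (replicate n 1#) x)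
      ≈⟨ solve 3 (λ x o E → (x :- o) :* (o :+ x :* E) := (x :- o) :* o :+ x :* ((x :- o) :* E))
                 refl x 1# _ ⟩
    (x + - 1#) * 1# + x * ((x + - 1#) * eval (replicate n 1#) x)
      ≈⟨ +-cong (*-identityʳ _) (*-congˡ (geometric-sum n x)) ⟩
    (x + - 1#) + x * (pow x n + - 1#)
      ≈⟨ solve 3 (λ x o A → (x :- o) :+ x :* (A :- o) := (x :* A :- o) :+ (x :- x :* o)) refl x 1# _ ⟩
    (x * pow x n + - 1#) + (x + - (x * 1#))
      ≈⟨ +-congˡ (trans (+-congˡ (-‿cong (*-identityʳ x))) (-‿inverseʳ x)) ⟩
    (x * pow x n + - 1#) + 0#
      ≈⟨ +-identityʳ _ ⟩
    x * pow x n + - 1#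
      ∎

  eval-ones-at-1# : ∀ n → eval (replicate n 1#) 1# ≈ nat n
  eval-ones-at-1# zero = refl
  eval-ones-at-1# (suc n) = +-congˡ (trans (*-identityˡ _) (eval-ones-at-1# n))

  -- The quotient of P by x - r, by synthetic division.
  quot : Carrier → Poly → Poly
  quot r [] = []
  quot r (a ∷ []) = []
  quot r (a ∷ b ∷ bs) = eval (b ∷ bs) r ∷ quot r (b ∷ bs)

  eval-quot : ∀ r P x → eval P x ≈ (x + - r) * eval (quot r P) x + eval P r
  eval-quot r [] x = solve 2 (λ x r → con (+ 0) := (x :- r) :* con (+ 0) :+ con (+ 0)) refl x r
  eval-quot r (a ∷ []) x = solve 3 (λ a x r → a :+ x :* con (+ 0) := (x :- r) :* con (+ 0) :+ (a :+ r :* con (+ 0)))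
                                 refl a x r
  eval-quot r (a ∷ b ∷ bs) x = begin
    a + x * eval (b ∷ bs) x
      ≈⟨ +-congˡ (*-congˡ (eval-quot r (b ∷ bs) x)) ⟩
    a + x * ((x + - r) * eval (quot r (b ∷ bs)) x + eval (b ∷ bs) r)
      ≈⟨ solve 5 (λ a x r Q E → a :+ x :* ((x :- r) :* Q :+ E) := (x :- r) :* (E :+ x :* Q) :+ (a :+ r :* E))
               refl a x r _ _ ⟩
    (x + - r) * (eval (b ∷ bs) r + x * eval (quot r (b ∷ bs)) x) + (a + r * eval (b ∷ bs) r)
      ∎

  factor-theorem : ∀ r P → eval P r ≈ 0# → ∀ x → eval P x ≈ (x + - r) * eval (quot r P) x
  factor-theorem r P Pr≈0 x = trans (eval-quot r P x) (trans (+-congˡ Pr≈0) (+-identityʳ _))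

  length-quot : ∀ r a as → length (quot r (a ∷ as)) ≡.≡ length as
  length-quot r a [] = ≡.refl
  length-quot r a (b ∷ bs) = ≡.cong suc (length-quot r b bs)

  length-quot-< : ∀ r P → NonZeroPoly P → length (quot r P) < length P
  length-quot-< r [] P≉0 = ⊥-elim (P≉0 (λ _ → refl))
  length-quot-< r (a ∷ as) _ = ℕ.s≤s (ℕ.≤-reflexive (length-quot r a as))

  zeroPoly-quot : ∀ r P → eval P r ≈ 0# → ZeroPoly (quot r P) → ZeroPoly P
  zeroPoly-quot r [] _ _ n = refl
  zeroPoly-quot r (a ∷ []) Pr≈0 _ zero = trans (sym (solve 2 (λ a r → a :+ r :* con (+ 0) := a) refl a r)) Pr≈0
  zeroPoly-quot r (a ∷ []) _ _ (suc n) = refl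
  zeroPoly-quot r (a ∷ b ∷ bs) Pr≈0 Q≈0 zero = begin
    a                       ≈⟨ solve 2 (λ a r → a := a :+ r :* con (+ 0)) refl a r ⟩
    a + r * 0#              ≈⟨ +-congˡ (*-congˡ (Q≈0 0)) ⟨
    a + r * eval (b ∷ bs) r ≈⟨ Pr≈0 ⟩
    0#                      ∎
  zeroPoly-quot r (a ∷ b ∷ bs) _ Q≈0 (suc n) = zeroPoly-quot r (b ∷ bs) (Q≈0 0) (λ m → Q≈0 (suc m)) n

module Field {c ℓ : Level} (K : ACField c ℓ) where
  open ACField K
  open Powers commRing
  open IntegerSolver commRing using (solve; _:=_; _:*_; _:-_)
  open RingProperties ring using (x∙y⁻¹≈ε⇒x≈y; +-cancelˡ)
  open import Relation.Binary.Reasoning.Setoid setoid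

  1≉0 : ¬ 1# ≈ 0#
  1≉0 1≈0 = 0≉1 (sym 1≈0)

  x*y≈0⇒y≈0 : ∀ {x y} → ¬ x ≈ 0# → x * y ≈ 0# → y ≈ 0#
  x*y≈0⇒y≈0 {x} {y} x≉0 xy≈0 with inverse x x≉0
  ... | x⁻¹ , x*x⁻¹≈1 = begin
    y               ≈⟨ *-identityˡ y ⟨
    1# * y          ≈⟨ *-congʳ (trans (*-comm x⁻¹ x) x*x⁻¹≈1) ⟨
    (x⁻¹ * x) * y   ≈⟨ *-assoc x⁻¹ x y ⟩
    x⁻¹ * (x * y)   ≈⟨ *-congˡ xy≈0 ⟩
    x⁻¹ * 0#        ≈⟨ zeroʳ x⁻¹ ⟩
    0#              ∎

  *-nonZero : ∀ {x y} → ¬ x ≈ 0# → ¬ y ≈ 0# → ¬ x * y ≈ 0#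
  *-nonZero x≉0 y≉0 xy≈0 = y≉0 (x*y≈0⇒y≈0 x≉0 xy≈0)

  *-cancelˡ-nonZero : ∀ {z x y} → ¬ z ≈ 0# → z * x ≈ z * y → x ≈ y
  *-cancelˡ-nonZero {z} {x} {y} z≉0 zx≈zy = x∙y⁻¹≈ε⇒x≈y x y (x*y≈0⇒y≈0 z≉0 (begin
    z * (x + - y)      ≈⟨ solve 3 (λ z x y → z :* (x :- y) := z :* x :- z :* y) refl z x y ⟩
    z * x + - (z * y)  ≈⟨ +-congʳ zx≈zy ⟩
    z * y + - (z * y)  ≈⟨ -‿inverseʳ (z * y) ⟩
    0#                 ∎))

  pow-nonZero : ∀ {x} n → ¬ x ≈ 0# → ¬ pow x n ≈ 0#
  pow-nonZero zero x≉0 = 1≉0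
  pow-nonZero (suc n) x≉0 = *-nonZero x≉0 (pow-nonZero n x≉0)

  nat-injective : ∀ m n → nat m ≈ nat n → m ≡.≡ n
  nat-injective zero zero _ = ≡.refl
  nat-injective zero (suc n) 0≈n+1 = ⊥-elim (char0 n (sym 0≈n+1))
  nat-injective (suc m) zero m+1≈0 = ⊥-elim (char0 m m+1≈0)
  nat-injective (suc m) (suc n) m+1≈n+1 = ≡.cong suc (nat-injective m n (+-cancelˡ 1# _ _ m+1≈n+1))

module PolynomialRoots {c ℓ : Level} (K : ACField c ℓ) where
  open ACField K
  open Field K
  open Polynomials commRing
  open RingProperties ring using (x∙y⁻¹≈ε⇒x≈y; x≈y⇒x∙y⁻¹≈ε)
  open import Relation.Binary.Reasoning.Setoid setoid

  quot-root : ∀ P {r x} → eval P r ≈ 0# → eval P x ≈ 0# → ¬ x ≈ r → eval (quot r P) x ≈ 0#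
  quot-root P {r} {x} Pr≈0 Px≈0 x≉r =
    x*y≈0⇒y≈0 (λ x-r≈0 → x≉r (x∙y⁻¹≈ε⇒x≈y x r x-r≈0)) (trans (sym (factor-theorem r P Pr≈0 x)) Px≈0)

  Distinct : List Carrier → Set (c ⊔ ℓ)
  Distinct = AllPairs (λ x y → ¬ x ≈ y)

  RootOfEither : Poly → Poly → Carrier → Set ℓ
  RootOfEither C D x = ¬ ¬ (eval C x ≈ 0# ⊎ eval D x ≈ 0#)

  rootOfEither-quot : ∀ C D {x y} → eval C x ≈ 0# → ¬ x ≈ y → RootOfEither C D y → RootOfEither (quot x C) D y
  rootOfEither-quot C D Cx≈0 x≉y =
    ¬¬-map (Sum.map₁ (λ Cy≈0 → quot-root C Cx≈0 Cy≈0 (λ y≈x → x≉y (sym y≈x))))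

  too-many-roots : ∀ {xs} → Distinct xs → ∀ C D → length C ℕ.+ length D ≤ length xs →
                   All (RootOfEither C D) xs → NonZeroPoly C → NonZeroPoly D → ⊥
  too-many-roots [] [] D _ _ C≉0 _ = C≉0 (λ _ → refl)
  too-many-roots {x ∷ xs} (x≉xs ∷ distinct) C D len roots C≉0 D≉0 = All.head roots λ where
      (inj₁ Cx≈0) → divide C D Cx≈0 len (All.tail roots) C≉0 D≉0
      (inj₂ Dx≈0) → divide D C Dx≈0 (≡.subst (_≤ suc (length xs)) (ℕ.+-comm (length C) (length D)) len)
                      (All.map (¬¬-map Sum.swap) (All.tail roots)) D≉0 C≉0
    where
    divide : ∀ C D → eval C x ≈ 0# → length C ℕ.+ length D ≤ suc (length xs) →
             All (RootOfEither C D) xs → NonZeroPoly C → NonZeroPoly D → ⊥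
    divide [] D _ _ _ C≉0 _ = C≉0 (λ _ → refl)
    divide C@(a ∷ as) D Cx≈0 len roots C≉0 D≉0 =
      too-many-roots distinct (quot x C) D
        (≡.subst (λ k → k ℕ.+ length D ≤ length xs) (≡.sym (length-quot x a as)) (ℕ.s≤s⁻¹ len))
        (All.zipWith (λ (x≉y , root) → rootOfEither-quot C D Cx≈0 x≉y root) (x≉xs , roots))
        (λ quot≈0 → C≉0 (zeroPoly-quot x C Cx≈0 quot≈0)) D≉0

  distinct-nats : ∀ n → Distinct (applyUpTo nat n)
  distinct-nats n = AllPairs.applyUpTo⁺₁ nat n (λ {i} {j} i<j _ i≈j → ℕ.<⇒≢ i<j (nat-injective i j i≈j))

  -- K is infinite (characteristic 0), so a polynomial vanishing off the zeros of C is zero.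
  zeroPoly-offZeros : ∀ C D → NonZeroPoly C → (∀ x → ¬ eval C x ≈ 0# → eval D x ≈ 0#) → ¬ NonZeroPoly D
  zeroPoly-offZeros C D C≉0 D≈0 D≉0 =
    too-many-roots (distinct-nats n) C D (ℕ.≤-reflexive (≡.sym (List.length-applyUpTo nat n)))
      (All.applyUpTo⁺₂ nat n (λ i notRoot → notRoot (inj₂ (D≈0 (nat i) (λ C≈0 → notRoot (inj₁ C≈0))))))
      C≉0 D≉0
    where
    n = length C ℕ.+ length D

  ≋-offZeros : ∀ C P Q → NonZeroPoly C → (∀ x → ¬ eval C x ≈ 0# → eval P x ≈ eval Q x) → ¬ ¬ (P ≋ Q)
  ≋-offZeros C P Q C≉0 P≈Q ¬P≋Q = zeroPoly-offZeros C (P +ₚ negₚ Q) C≉0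
    (λ x Cx≉0 → trans (eval-+ₚ P (negₚ Q) x)
                      (trans (+-congˡ (eval-negₚ Q x)) (x≈y⇒x∙y⁻¹≈ε (P≈Q x Cx≉0))))
    (λ P-Q≈0 → ¬P≋Q (≋-fromDifference P Q P-Q≈0))

  nonZero-*ₚ : ∀ C D → NonZeroPoly C → NonZeroPoly D → NonZeroPoly (C *ₚ D)
  nonZero-*ₚ C D C≉0 D≉0 CD≈0 = zeroPoly-offZeros C D C≉0
    (λ x Cx≉0 → x*y≈0⇒y≈0 Cx≉0 (trans (sym (eval-*ₚ C D x)) (eval-zeroPoly (C *ₚ D) x CD≈0))) D≉0

  nonZero-subst-pow : ∀ k P → NonZeroPoly P → NonZeroPoly (subst-pow (suc k) P)
  nonZero-subst-pow k P P≉0 σP≈0 = P≉0 (zeroPoly-subst-pow k P σP≈0)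

module Radicals {c ℓ : Level} (K : ACField c ℓ) where
  open ACField K
  open Field K
  open Polynomials commRing
  open RingProperties ring using (x∙y⁻¹≈ε⇒x≈y)
  open import Relation.Binary.Reasoning.Setoid setoid

  root : ∀ n γ → ∃[ ω ] (pow ω (suc n) ≈ γ)
  root n γ = ω , x∙y⁻¹≈ε⇒x≈y _ _ (begin
    ω * pow ω n + - γ
      ≈⟨ +-comm _ _ ⟩
    - γ + ω * pow ω n
      ≈⟨ +-congˡ (*-congˡ (trans (*-congˡ eval-1) (*-identityʳ _))) ⟨
    - γ + ω * (pow ω n * eval (1# ∷ []) ω)
      ≈⟨ +-congˡ (*-congˡ (eval-padding n (1# ∷ []) ω)) ⟨
    - γ + ω * eval (replicate n 0# ++ (1# ∷ [])) ω
      ≈⟨ Pω≈0 ⟩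
    0#
      ∎)
    where
    P = (- γ) ∷ (replicate n 0# ++ (1# ∷ []))
    leading : coeff P (suc n) ≡.≡ 1#
    leading = ≡.trans (≡.cong (coeff (replicate n 0# ++ (1# ∷ []))) (≡.sym (ℕ.+-identityʳ n)))
                      (coeff-padding n (1# ∷ []) 0)
    ω-spec = algClosed P (suc n , ℕ.s≤s ℕ.z≤n , λ lead≈0 → 1≉0 (≡.subst (_≈ 0#) leading lead≈0))
    ω = proj₁ ω-spec
    Pω≈0 = proj₂ ω-spec
    eval-1 : eval (1# ∷ []) ω ≈ 1#
    eval-1 = trans (+-congˡ (zeroʳ ω)) (+-identityʳ 1#)

  nontrivial-root-of-unity : ∀ n → ∃[ ε ] (pow ε (suc (suc n)) ≈ 1# × ¬ ε ≈ 1#)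
  nontrivial-root-of-unity n = ε , εⁿ⁺²≈1 , ε≉1
    where
    Φ = replicate (suc (suc n)) 1#
    leading : ∀ m → coeff (replicate (suc m) 1#) m ≡.≡ 1#
    leading zero = ≡.refl
    leading (suc m) = leading m
    ε-spec = algClosed Φ (suc n , ℕ.s≤s ℕ.z≤n , λ lead≈0 → 1≉0 (≡.subst (_≈ 0#) (leading (suc n)) lead≈0))
    ε = proj₁ ε-spec
    Φε≈0 = proj₂ ε-spec
    εⁿ⁺²≈1 : pow ε (suc (suc n)) ≈ 1#
    εⁿ⁺²≈1 = x∙y⁻¹≈ε⇒x≈y _ _ (begin
      pow ε (suc (suc n)) + - 1#  ≈⟨ geometric-sum (suc (suc n)) ε ⟨
      (ε + - 1#) * eval Φ ε       ≈⟨ *-congˡ Φε≈0 ⟩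
      (ε + - 1#) * 0#             ≈⟨ zeroʳ _ ⟩
      0#                          ∎)
    ε≉1 : ¬ ε ≈ 1#
    ε≉1 ε≈1 = char0 (suc n) (begin
      nat (suc (suc n))  ≈⟨ eval-ones-at-1# (suc (suc n)) ⟨
      eval Φ 1#          ≈⟨ eval-congʳ Φ ε≈1 ⟨
      eval Φ ε           ≈⟨ Φε≈0 ⟩
      0#                 ∎)

module RationalFunctions {c ℓ : Level} (K : ACField c ℓ) (p : ℕ) where
  open ACField K
  open Theory K p
  open Field K
  open Polynomials commRing
  open PolynomialRoots K
  open IntegerSolver commRing using (solve; _:=_; _:*_; _:-_; :-_)
  open import Relation.Binary.Reasoning.Setoid setoid

  _≃[_]_ : RatFun → Carrier → RatFun → Set ℓ
  F ≃[ x ] G = eval (num F) x * eval (den G) x ≈ eval (num G) x * eval (den F) x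

  ≃-pointwise : ∀ F G → F ≃ G → ∀ x → F ≃[ x ] G
  ≃-pointwise F G F≃G x = begin
    eval (num F) x * eval (den G) x  ≈⟨ eval-*ₚ (num F) (den G) x ⟨
    eval (num F *ₚ den G) x          ≈⟨ eval-congˡ (num F *ₚ den G) (num G *ₚ den F) x F≃G ⟩
    eval (num G *ₚ den F) x          ≈⟨ eval-*ₚ (num G) (den F) x ⟩
    eval (num G) x * eval (den F) x  ∎

  ≃-offZeros : ∀ C F G → NonZeroPoly C → (∀ x → ¬ eval C x ≈ 0# → F ≃[ x ] G) → ¬ ¬ (F ≃ G)
  ≃-offZeros C F G C≉0 F≃G = ≋-offZeros C (num F *ₚ den G) (num G *ₚ den F) C≉0 λ x Cx≉0 →
    trans (eval-*ₚ (num F) (den G) x) (trans (F≃G x Cx≉0) (sym (eval-*ₚ (num G) (den F) x)))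

  ≃-everywhere : ∀ F G → (∀ x → F ≃[ x ] G) → ¬ ¬ (F ≃ G)
  ≃-everywhere F G F≃G = ≃-offZeros (1# ∷ []) F G (λ 1≈0 → 1≉0 (1≈0 0)) (λ x _ → F≃G x)

  ≃-sym : ∀ F G → F ≃ G → G ≃ F
  ≃-sym F G F≃G n = sym (F≃G n)

  ≃-trans : ∀ F G H → NonZeroPoly (den G) → F ≃ G → G ≃ H → ¬ ¬ (F ≃ H)
  ≃-trans F G H G≉0 F≃G G≃H = ≃-offZeros (den G) F H G≉0 λ x Gx≉0 →
    let FN = eval (num F) x; FD = eval (den F) x; GN = eval (num G) x; GD = eval (den G) x
        HN = eval (num H) x; HD = eval (den H) x
    in *-cancelˡ-nonZero Gx≉0 (begin
      GD * (FN * HD)  ≈⟨ solve 3 (λ GD FN HD → GD :* (FN :* HD) := (FN :* GD) :* HD) refl GD FN HD ⟩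
      (FN * GD) * HD  ≈⟨ *-congʳ (≃-pointwise F G F≃G x) ⟩
      (GN * FD) * HD  ≈⟨ solve 3 (λ GN FD HD → (GN :* FD) :* HD := FD :* (GN :* HD)) refl GN FD HD ⟩
      FD * (GN * HD)  ≈⟨ *-congˡ (≃-pointwise G H G≃H x) ⟩
      FD * (HN * GD)  ≈⟨ solve 3 (λ FD HN GD → FD :* (HN :* GD) := GD :* (HN :* FD)) refl FD HN GD ⟩
      GD * (HN * FD)  ∎)

  num-−ᵣ : ∀ F G x →
           eval (num (F −ᵣ G)) x ≈ eval (num F) x * eval (den G) x + - (eval (num G) x * eval (den F) x)
  num-−ᵣ F G x = trans (eval-+ₚ (num F *ₚ den G) _ x)
    (+-cong (eval-*ₚ (num F) (den G) x)
            (trans (eval-negₚ (num G *ₚ den F) x) (-‿cong (eval-*ₚ (num G) (den F) x))))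

  den-−ᵣ : ∀ F G x → eval (den (F −ᵣ G)) x ≈ eval (den F) x * eval (den G) x
  den-−ᵣ F G x = eval-*ₚ (den F) (den G) x

  nonZero-den-−ᵣ : ∀ F G → NonZeroPoly (den F) → NonZeroPoly (den G) → NonZeroPoly (den (F −ᵣ G))
  nonZero-den-−ᵣ F G = nonZero-*ₚ (den F) (den G)

  den-−ᵣ-nonZeroAt : ∀ F G {α} → ¬ eval (den F) α ≈ 0# → ¬ eval (den G) α ≈ 0# → ¬ eval (den (F −ᵣ G)) α ≈ 0#
  den-−ᵣ-nonZeroAt F G {α} Fα≉0 Gα≉0 F-Gα≈0 = *-nonZero Fα≉0 Gα≉0 (trans (sym (den-−ᵣ F G α)) F-Gα≈0)

  pole-of-vanishing-den : ∀ F {α} → ¬ eval (num F) α ≈ 0# → eval (den F) α ≈ 0# → IsPole F α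
  pole-of-vanishing-den F {α} Fα≉0 Dα≈0 (G , Gα≉0 , F≃G) = *-nonZero Fα≉0 Gα≉0 (begin
    eval (num F) α * eval (den G) α  ≈⟨ ≃-pointwise F G F≃G α ⟩
    eval (num G) α * eval (den F) α  ≈⟨ *-congˡ Dα≈0 ⟩
    eval (num G) α * 0#              ≈⟨ zeroʳ _ ⟩
    0#                               ∎)

  noPole-resp-≃ : ∀ F G {α} → NonZeroPoly (den G) → F ≃ G → ¬ IsPole G α → ¬ IsPole F α
  noPole-resp-≃ F G G≉0 F≃G noPoleG poleF = noPoleG λ (W , Wα≉0 , G≃W) →
    ≃-trans F G W G≉0 F≃G G≃W (λ F≃W → poleF (W , Wα≉0 , F≃W))

  −ᵣ-cong-at : ∀ F G V W {x} → F ≃[ x ] V → G ≃[ x ] W → (F −ᵣ G) ≃[ x ] (V −ᵣ W)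
  −ᵣ-cong-at F G V W {x} F≃V G≃W = begin
    eval (num (F −ᵣ G)) x * eval (den (V −ᵣ W)) x
      ≈⟨ *-cong (num-−ᵣ F G x) (den-−ᵣ V W x) ⟩
    (FN * GD + - (GN * FD)) * (VD * WD)
      ≈⟨ solve 6 (λ FN GD GN FD VD WD → (FN :* GD :- GN :* FD) :* (VD :* WD)
                                    := (FN :* VD) :* (GD :* WD) :- (GN :* WD) :* (FD :* VD))
               refl FN GD GN FD VD WD ⟩
    (FN * VD) * (GD * WD) + - ((GN * WD) * (FD * VD))
      ≈⟨ +-cong (*-congʳ F≃V) (-‿cong (*-congʳ G≃W)) ⟩
    (VN * FD) * (GD * WD) + - ((WN * GD) * (FD * VD))
      ≈⟨ solve 6 (λ VN FD GD WD WN VD → (VN :* FD) :* (GD :* WD) :- (WN :* GD) :* (FD :* VD)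
                                    := (VN :* WD :- WN :* VD) :* (FD :* GD))
               refl VN FD GD WD WN VD ⟩
    (VN * WD + - (WN * VD)) * (FD * GD)
      ≈⟨ *-cong (num-−ᵣ V W x) (den-−ᵣ F G x) ⟨
    eval (num (V −ᵣ W)) x * eval (den (F −ᵣ G)) x
      ∎
    where
    FN = eval (num F) x; FD = eval (den F) x; GN = eval (num G) x; GD = eval (den G) x
    VN = eval (num V) x; VD = eval (den V) x; WN = eval (num W) x; WD = eval (den W) x

  scaleᵣ-cong-at : ∀ k F V {x} → F ≃[ x ] V → scaleᵣ k F ≃[ x ] scaleᵣ k V
  scaleᵣ-cong-at k F V {x} F≃V = begin
    eval (scale k (num F)) x * eval (den V) x  ≈⟨ *-congʳ (eval-scale k (num F) x) ⟩
    (k * eval (num F) x) * eval (den V) x      ≈⟨ *-assoc _ _ _ ⟩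
    k * (eval (num F) x * eval (den V) x)      ≈⟨ *-congˡ F≃V ⟩
    k * (eval (num V) x * eval (den F) x)      ≈⟨ *-assoc _ _ _ ⟨
    (k * eval (num V) x) * eval (den F) x      ≈⟨ *-congʳ (eval-scale k (num V) x) ⟨
    eval (scale k (num V)) x * eval (den F) x  ∎

  noPole-−ᵣ : ∀ F G {α} → ¬ IsPole F α → ¬ IsPole G α → ¬ IsPole (F −ᵣ G) α
  noPole-−ᵣ F G noPoleF noPoleG poleF-G = noPoleF λ (V , Vα≉0 , F≃V) → noPoleG λ (W , Wα≉0 , G≃W) →
    ≃-everywhere (F −ᵣ G) (V −ᵣ W) (λ x → −ᵣ-cong-at F G V W (≃-pointwise F V F≃V x) (≃-pointwise G W G≃W x))
      λ F-G≃V-W → poleF-G (V −ᵣ W , den-−ᵣ-nonZeroAt V W Vα≉0 Wα≉0 , F-G≃V-W)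

  noPole-scaleᵣ : ∀ k F {α} → ¬ IsPole F α → ¬ IsPole (scaleᵣ k F) α
  noPole-scaleᵣ k F noPoleF poleKF = noPoleF λ (V , Vα≉0 , F≃V) →
    ≃-everywhere (scaleᵣ k F) (scaleᵣ k V) (λ x → scaleᵣ-cong-at k F V (≃-pointwise F V F≃V x))
      λ kF≃kV → poleKF (scaleᵣ k V , Vα≉0 , kF≃kV)

  isPole-subtrahend : ∀ F G {α} → NonZeroPoly (den F) → NonZeroPoly (den G) →
                      IsPole F α → ¬ IsPole (F −ᵣ G) α → IsPole G α
  isPole-subtrahend F G F≉0 G≉0 poleF noPoleF-G regularG =
    ≃-everywhere F F′ regroup λ F≃F′ →
      noPole-resp-≃ F F′ (nonZero-*ₚ (den G) (den (F −ᵣ G)) G≉0 (nonZero-den-−ᵣ F G F≉0 G≉0)) F≃F′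
        (noPole-−ᵣ G (scaleᵣ (- 1#) (F −ᵣ G)) (λ poleG → poleG regularG) (noPole-scaleᵣ (- 1#) (F −ᵣ G) noPoleF-G))
        poleF
    where
    F′ = G −ᵣ scaleᵣ (- 1#) (F −ᵣ G)
    regroup : ∀ x → F ≃[ x ] F′
    regroup x = begin
      FN * eval (den F′) x
        ≈⟨ *-congˡ (trans (den-−ᵣ G (scaleᵣ (- 1#) (F −ᵣ G)) x) (*-congˡ (den-−ᵣ F G x))) ⟩
      FN * (GD * (FD * GD))
        ≈⟨ solve 4 (λ FN FD GN GD → FN :* (GD :* (FD :* GD))
                                := (GN :* (FD :* GD) :- (:- (FN :* GD :- GN :* FD)) :* GD) :* FD)
                 refl FN FD GN GD ⟩
      (GN * (FD * GD) + - (- (FN * GD + - (GN * FD)) * GD)) * FD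
        ≈⟨ *-congʳ (+-congˡ (-‿cong (*-congʳ (-‿cong (num-−ᵣ F G x))))) ⟨
      (GN * (FD * GD) + - (- eval (num (F −ᵣ G)) x * GD)) * FD
        ≈⟨ *-congʳ (+-cong (*-congˡ (den-−ᵣ F G x)) (-‿cong (*-congʳ (eval-negₚ (num (F −ᵣ G)) x)))) ⟨
      (GN * eval (den (F −ᵣ G)) x + - (eval (num (scaleᵣ (- 1#) (F −ᵣ G))) x * GD)) * FD
        ≈⟨ *-congʳ (num-−ᵣ G (scaleᵣ (- 1#) (F −ᵣ G)) x) ⟨
      eval (num F′) x * FD
        ∎
      where
      FN = eval (num F) x; FD = eval (den F) x; GN = eval (num G) x; GD = eval (den G) x

  isPole-minuend : ∀ F G {α} → NonZeroPoly (den F) → NonZeroPoly (den G) →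
                   IsPole G α → ¬ IsPole (F −ᵣ G) α → IsPole F α
  isPole-minuend F G F≉0 G≉0 poleG noPoleF-G regularF =
    ≃-everywhere G G′ regroup λ G≃G′ →
      noPole-resp-≃ G G′ (nonZero-*ₚ (den F) (den (F −ᵣ G)) F≉0 (nonZero-den-−ᵣ F G F≉0 G≉0)) G≃G′
        (noPole-−ᵣ F (F −ᵣ G) (λ poleF → poleF regularF) noPoleF-G) poleG
    where
    G′ = F −ᵣ (F −ᵣ G)
    regroup : ∀ x → G ≃[ x ] G′
    regroup x = begin
      GN * eval (den G′) x
        ≈⟨ *-congˡ (trans (den-−ᵣ F (F −ᵣ G) x) (*-congˡ (den-−ᵣ F G x))) ⟩
      GN * (FD * (FD * GD))
        ≈⟨ solve 4 (λ FN FD GN GD → GN :* (FD :* (FD :* GD))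
                                := (FN :* (FD :* GD) :- (FN :* GD :- GN :* FD) :* FD) :* GD)
                 refl FN FD GN GD ⟩
      (FN * (FD * GD) + - ((FN * GD + - (GN * FD)) * FD)) * GD
        ≈⟨ *-congʳ (+-cong (*-congˡ (den-−ᵣ F G x)) (-‿cong (*-congʳ (num-−ᵣ F G x)))) ⟨
      (FN * eval (den (F −ᵣ G)) x + - (eval (num (F −ᵣ G)) x * FD)) * GD
        ≈⟨ *-congʳ (num-−ᵣ F (F −ᵣ G) x) ⟨
      eval (num G′) x * GD
        ∎
      where
      FN = eval (num F) x; FD = eval (den F) x; GN = eval (num G) x; GD = eval (den G) x

module Mahler {c ℓ : Level} (K : ACField c ℓ) (q : ℕ) where
  open ACField K
  open Powers commRing
  open Field K
  open Polynomials commRing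
  open PolynomialRoots K
  open Radicals K
  open import Relation.Binary.Reasoning.Setoid setoid

  p : ℕ
  p = suc (suc q)

  open Theory K p
  open RationalFunctions K p
  open IntegerSolver commRing using (solve; _:=_; _:*_; _:-_; con)

  -- N = 0 is excluded by coprimality, as p ≥ 2.
  CoprimeRootOfUnity : Carrier → Set ℓ
  CoprimeRootOfUnity ω = ∃[ N ] (Coprime N p × pow ω N ≈ 1#)

  coprimeRoot-cancel : ∀ {ε ω} → CoprimeRootOfUnity ω → CoprimeRootOfUnity (ε * ω) → CoprimeRootOfUnity ε
  coprimeRoot-cancel {ε} {ω} (m , m⊥p , ωᵐ≈1) (n , n⊥p , εωⁿ≈1) = n ℕ.* m , coprime-*ˡ n⊥p m⊥p , (begin
    pow ε (n ℕ.* m)                    ≈⟨ *-identityʳ _ ⟨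
    pow ε (n ℕ.* m) * 1#               ≈⟨ *-congˡ (pow≈1-multiple m n ωᵐ≈1) ⟨
    pow ε (n ℕ.* m) * pow ω (n ℕ.* m)  ≈⟨ pow-distrib-* ε ω (n ℕ.* m) ⟨
    pow (ε * ω) (n ℕ.* m)              ≡⟨ ≡.cong (pow (ε * ω)) (ℕ.*-comm n m) ⟩
    pow (ε * ω) (m ℕ.* n)              ≈⟨ pow≈1-multiple n m εωⁿ≈1 ⟩
    1#                                 ∎)

  coprimeRoot-pthRoot≈1 : ∀ {ε} → CoprimeRootOfUnity ε → pow ε p ≈ 1# → ε ≈ 1#
  coprimeRoot-pthRoot≈1 (N , N⊥p , εᴺ≈1) εᵖ≈1 = pow≈1-coprime⇒≈1 N p εᴺ≈1 εᵖ≈1 N⊥p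

  root-outside-coprimeRoots : ∀ γ → ¬ ¬ (∃[ ω ] (pow ω p ≈ γ × ¬ CoprimeRootOfUnity ω))
  root-outside-coprimeRoots γ none =
    let ω , ωᵖ≈γ = root (suc q) γ
        ε , εᵖ≈1 , ε≉1 = nontrivial-root-of-unity q
        εωᵖ≈γ = trans (pow-distrib-* ε ω p) (trans (*-cong εᵖ≈1 ωᵖ≈γ) (*-identityˡ γ))
    in none (ω , ωᵖ≈γ , λ ω-root → none (ε * ω , εωᵖ≈γ , λ εω-root →
         ε≉1 (coprimeRoot-pthRoot≈1 (coprimeRoot-cancel ω-root εω-root) εᵖ≈1)))

  IteratedPower : Carrier → Carrier → Set ℓ
  IteratedPower ω x = ∃[ j ] (x ≈ pow ω (p ℕ.^ suc j))

  iteratedPower-base : ∀ {ω γ} → pow ω p ≈ γ → IteratedPower ω γ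
  iteratedPower-base {ω} {γ} ωᵖ≈γ = 0 , (begin
    γ                     ≈⟨ ωᵖ≈γ ⟨
    pow ω p               ≈⟨ *-identityʳ _ ⟨
    pow (pow ω p) 1       ≈⟨ pow-* ω p 1 ⟨
    pow ω (p ℕ.* 1)       ∎)

  iteratedPower-step : ∀ {ω γ x} → pow ω p ≈ γ → IteratedPower γ x → IteratedPower ω x
  iteratedPower-step {ω} {γ} {x} ωᵖ≈γ (j , x≈γ^) = suc j , (begin
    x                              ≈⟨ x≈γ^ ⟩
    pow γ (p ℕ.^ suc j)            ≈⟨ pow-congˡ (p ℕ.^ suc j) ωᵖ≈γ ⟨
    pow (pow ω p) (p ℕ.^ suc j)    ≈⟨ pow-* ω p (p ℕ.^ suc j) ⟨
    pow ω (p ℕ.^ suc (suc j))      ∎)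

  coprimeRoot-of-periodic : ∀ {ω} → ¬ ω ≈ 0# → IteratedPower ω ω → CoprimeRootOfUnity ω
  coprimeRoot-of-periodic {ω} ω≉0 (j , ω≈ω^) = N , coprime-pred p∣1+N , ωᴺ≈1
    where
    instance _ = ℕ.m^n≢0 p (suc j)
    N = ℕ.pred (p ℕ.^ suc j)
    1+N≡pʲ⁺¹ : suc N ≡.≡ p ℕ.^ suc j
    1+N≡pʲ⁺¹ = ℕ.suc-pred (p ℕ.^ suc j)
    p∣1+N : p ∣ suc N
    p∣1+N = ≡.subst (p ∣_) (≡.sym 1+N≡pʲ⁺¹) (m∣m*n (p ℕ.^ j))
    ωᴺ≈1 : pow ω N ≈ 1#
    ωᴺ≈1 = sym (*-cancelˡ-nonZero ω≉0 (begin
      ω * 1#                ≈⟨ *-identityʳ ω ⟩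
      ω                     ≈⟨ ω≈ω^ ⟩
      pow ω (p ℕ.^ suc j)   ≡⟨ ≡.cong (pow ω) 1+N≡pʲ⁺¹ ⟨
      ω * pow ω N           ∎))

  inTree-pow : ∀ {β α} → InTree β α → InTree β (pow α p)
  inTree-pow {β} {α} (α≉0 , r , t , αʳ≈βᵗ) = pow-nonZero p α≉0 , r , suc t , (begin
    pow (pow α p) (p ℕ.^ r)    ≈⟨ pow-* α p (p ℕ.^ r) ⟨
    pow α (p ℕ.* p ℕ.^ r)      ≡⟨ ≡.cong (pow α) (ℕ.*-comm p (p ℕ.^ r)) ⟩
    pow α (p ℕ.^ r ℕ.* p)      ≈⟨ pow-* α (p ℕ.^ r) p ⟩
    pow (pow α (p ℕ.^ r)) p    ≈⟨ pow-congˡ p αʳ≈βᵗ ⟩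
    pow (pow β (p ℕ.^ t)) p    ≈⟨ pow-* β (p ℕ.^ t) p ⟨
    pow β (p ℕ.^ t ℕ.* p)      ≡⟨ ≡.cong (pow β) (ℕ.*-comm (p ℕ.^ t) p) ⟩
    pow β (p ℕ.* p ℕ.^ t)      ∎)

  inTree-root : ∀ {β γ ω} → InTree β γ → pow ω p ≈ γ → InTree β ω
  inTree-root {β} {γ} {ω} (γ≉0 , r , t , γʳ≈βᵗ) ωᵖ≈γ = ω≉0 , suc r , t , (begin
    pow ω (p ℕ.* p ℕ.^ r)      ≈⟨ pow-* ω p (p ℕ.^ r) ⟩
    pow (pow ω p) (p ℕ.^ r)    ≈⟨ pow-congˡ (p ℕ.^ r) ωᵖ≈γ ⟩
    pow γ (p ℕ.^ r)            ≈⟨ γʳ≈βᵗ ⟩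
    pow β (p ℕ.^ t)            ∎)
    where
    ω≉0 : ¬ ω ≈ 0#
    ω≉0 ω≈0 = γ≉0 (trans (sym ωᵖ≈γ) (trans (*-congʳ ω≈0) (zeroˡ _)))

  height-zero⇒coprimeRoot : ∀ {β ω} → IsHeight β ω 0 → CoprimeRootOfUnity ω
  height-zero⇒coprimeRoot {ω = ω} ((_ , n , (_ , ωⁿ≈1 , _) , n⊥p) , _) =
    n , n⊥p , trans (pow-congˡ n (sym (*-identityʳ ω))) ωⁿ≈1

  powλ-nonZero : ∀ λ' {s} → IsPowλ λ' s → ¬ s ≈ 0#
  powλ-nonZero (+ n) s≈pⁿ s≈0 = pow-nonZero n (char0 (suc q)) (trans (sym s≈pⁿ) s≈0)
  powλ-nonZero -[1+ n ] spⁿ⁺¹≈1 s≈0 = 0≉1 (trans (sym (zeroˡ _)) (trans (*-congʳ (sym s≈0)) spⁿ⁺¹≈1))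

  σ-cong-at : ∀ F G {x} → F ≃[ pow x p ] G → σ F ≃[ x ] σ G
  σ-cong-at F G {x} F≃G = begin
    eval (subst-pow p (num F)) x * eval (subst-pow p (den G)) x
      ≈⟨ *-cong (eval-subst-pow (suc q) (num F) x) (eval-subst-pow (suc q) (den G) x) ⟩
    eval (num F) (pow x p) * eval (den G) (pow x p)
      ≈⟨ F≃G ⟩
    eval (num G) (pow x p) * eval (den F) (pow x p)
      ≈⟨ *-cong (eval-subst-pow (suc q) (num G) x) (eval-subst-pow (suc q) (den F) x) ⟨
    eval (subst-pow p (num G)) x * eval (subst-pow p (den F)) x
      ∎

  cancel-common-root : ∀ a b γ → eval a γ ≈ 0# → eval b γ ≈ 0# → ¬ ¬ ((a / b) ≃ (quot γ a / quot γ b))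
  cancel-common-root a b γ aγ≈0 bγ≈0 = ≃-everywhere (a / b) (quot γ a / quot γ b) λ x →
    let u = x + - γ; a′ = eval (quot γ a) x; b′ = eval (quot γ b) x in begin
      eval a x * b′    ≈⟨ *-congʳ (factor-theorem γ a aγ≈0 x) ⟩
      (u * a′) * b′    ≈⟨ solve 3 (λ u a′ b′ → (u :* a′) :* b′ := a′ :* (u :* b′)) refl u a′ b′ ⟩
      a′ * (u * b′)    ≈⟨ *-congˡ (factor-theorem γ b bγ≈0 x) ⟨
      a′ * eval b x    ∎

  -- s stands for p^λ; only s ≠ 0 is used.
  module Delta (s : Carrier) (s≉0 : ¬ s ≈ 0#) where

    Δ : RatFun → RatFun
    Δ g = scaleᵣ s (σ g) −ᵣ g

    Δ-cong : ∀ F G → F ≃ G → ¬ ¬ (Δ F ≃ Δ G)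
    Δ-cong F G F≃G = ≃-everywhere (Δ F) (Δ G) λ x →
      −ᵣ-cong-at (scaleᵣ s (σ F)) F (scaleᵣ s (σ G)) G
        (scaleᵣ-cong-at s (σ F) (σ G) (σ-cong-at F G (≃-pointwise F G F≃G (pow x p))))
        (≃-pointwise F G F≃G x)

    num-Δ : ∀ a b x →
            eval (num (Δ (a / b))) x ≈ (s * eval a (pow x p)) * eval b x + - (eval a x * eval b (pow x p))
    num-Δ a b x = trans (num-−ᵣ (scaleᵣ s (σ (a / b))) (a / b) x)
      (+-cong (*-congʳ (trans (eval-scale s (subst-pow p a) x) (*-congˡ (eval-subst-pow (suc q) a x))))
              (-‿cong (*-congˡ (eval-subst-pow (suc q) b x))))

    den-Δ : ∀ a b x → eval (den (Δ (a / b))) x ≈ eval b (pow x p) * eval b x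
    den-Δ a b x = trans (den-−ᵣ (scaleᵣ s (σ (a / b))) (a / b) x) (*-congʳ (eval-subst-pow (suc q) b x))

    nonZero-den-Δ : ∀ a b → NonZeroPoly b → NonZeroPoly (den (Δ (a / b)))
    nonZero-den-Δ a b b≉0 = nonZero-*ₚ (subst-pow p b) b (nonZero-subst-pow (suc q) b b≉0) b≉0

    isPole-Δ-at-root : ∀ a b {γ ω} → eval b γ ≈ 0# → ¬ eval a γ ≈ 0# → pow ω p ≈ γ → ¬ eval b ω ≈ 0# →
                       IsPole (Δ (a / b)) ω
    isPole-Δ-at-root a b {γ} {ω} bγ≈0 aγ≉0 ωᵖ≈γ bω≉0 = pole-of-vanishing-den (Δ (a / b)) numω≉0 (begin
      eval (den (Δ (a / b))) ω   ≈⟨ den-Δ a b ω ⟩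
      eval b (pow ω p) * eval b ω ≈⟨ *-congʳ (trans (eval-congʳ b ωᵖ≈γ) bγ≈0) ⟩
      0# * eval b ω              ≈⟨ zeroˡ _ ⟩
      0#                         ∎)
      where
      numω≉0 : ¬ eval (num (Δ (a / b))) ω ≈ 0#
      numω≉0 numω≈0 = *-nonZero (*-nonZero s≉0 aγ≉0) bω≉0 (begin
        (s * eval a γ) * eval b ω
          ≈⟨ solve 2 (λ x y → x := x :- y :* con (+ 0)) refl _ (eval a ω) ⟩
        (s * eval a γ) * eval b ω + - (eval a ω * 0#)
          ≈⟨ +-cong (*-congʳ (*-congˡ (eval-congʳ a ωᵖ≈γ)))
                    (-‿cong (*-congˡ (trans (eval-congʳ b ωᵖ≈γ) bγ≈0))) ⟨
        (s * eval a (pow ω p)) * eval b ω + - (eval a ω * eval b (pow ω p))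
          ≈⟨ num-Δ a b ω ⟨
        eval (num (Δ (a / b))) ω
          ≈⟨ numω≈0 ⟩
        0# ∎)

    regular-Δ : ∀ a b {α} → ¬ eval b α ≈ 0# → ¬ eval b (pow α p) ≈ 0# → ¬ eval (den (Δ (a / b))) α ≈ 0#
    regular-Δ a b bα≉0 bαᵖ≉0 den≈0 = *-nonZero bαᵖ≉0 bα≉0 (trans (sym (den-Δ a b _)) den≈0)

    module Representation (h : RatFun) (h≉0 : NonZeroPoly (den h)) where

      Represents : Poly → Poly → Set ℓ
      Represents a b = h ≃ Δ (a / b)

      represents-cancel-common-root : ∀ a b γ → NonZeroPoly b → Represents a b →
                                      eval a γ ≈ 0# → eval b γ ≈ 0# → ¬ ¬ Represents (quot γ a) (quot γ b)
      represents-cancel-common-root a b γ b≉0 h≃Δ aγ≈0 bγ≈0 none =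
        cancel-common-root a b γ aγ≈0 bγ≈0 λ ab≃ab′ →
        Δ-cong (a / b) (quot γ a / quot γ b) ab≃ab′ λ Δ≃Δ′ →
        ≃-trans h (Δ (a / b)) (Δ (quot γ a / quot γ b)) (nonZero-den-Δ a b b≉0) h≃Δ Δ≃Δ′ none

      isPole-at-root : ∀ a b {γ ω} → Represents a b → eval b γ ≈ 0# → ¬ eval a γ ≈ 0# → pow ω p ≈ γ →
                       ¬ eval b ω ≈ 0# → IsPole h ω
      isPole-at-root a b h≃Δ bγ≈0 aγ≉0 ωᵖ≈γ bω≉0 regular =
        noPole-resp-≃ (Δ (a / b)) h h≉0 (≃-sym h (Δ (a / b)) h≃Δ) (λ pole → pole regular)
          (isPole-Δ-at-root a b bγ≈0 aγ≉0 ωᵖ≈γ bω≉0)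

      root-near-pole : ∀ a b {α} → Represents a b → IsPole h α → ¬ ¬ (eval b α ≈ 0# ⊎ eval b (pow α p) ≈ 0#)
      root-near-pole a b h≃Δ pole none = pole (Δ (a / b) , regular-Δ a b (none ∘ inj₁) (none ∘ inj₂) , h≃Δ)

      module RootChain (β : Carrier) (a b : Poly) (h≃Δ : Represents a b) (b≉0 : NonZeroPoly b)
                       (no-common-root : ∀ γ → eval b γ ≈ 0# → ¬ eval a γ ≈ 0#)
                       (poles-coprime : ∀ ω → InTree β ω → IsPole h ω → CoprimeRootOfUnity ω)
                       (initial-root : ¬ ¬ (∃[ γ ] (InTree β γ × eval b γ ≈ 0#))) where

        record Chain (k : ℕ) : Set (c ⊔ ℓ) where
          field
            top : Carrier
            below : List Carrier
            length-below : length below ≡.≡ k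
            top∈τ : InTree β top
            roots : All (λ x → eval b x ≈ 0#) (top ∷ below)
            below-top : All (IteratedPower top) below
            distinct : Distinct (top ∷ below)

        chain-start : ¬ ¬ Chain 0
        chain-start = ¬¬-map (λ (γ , γ∈τ , bγ≈0) → record
          { top = γ ; below = [] ; length-below = ≡.refl ; top∈τ = γ∈τ
          ; roots = bγ≈0 ∷ [] ; below-top = [] ; distinct = [] ∷ [] }) initial-root

        chain-extend : ∀ {k} → Chain k → ¬ ¬ Chain (suc k)
        chain-extend c none = root-outside-coprimeRoots top λ (ω , ωᵖ≈top , ω∉U) →
          let ω∈τ = inTree-root top∈τ ωᵖ≈top
              below-ω = iteratedPower-base ωᵖ≈top ∷ All.map (iteratedPower-step ωᵖ≈top) below-top
              fresh = λ {x} ((j , x≈ω^) : IteratedPower ω x) ω≈x →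
                        ω∉U (coprimeRoot-of-periodic (proj₁ ω∈τ) (j , trans ω≈x x≈ω^))
          in ¬¬-excluded-middle λ where
            (yes bω≈0) → none (record
              { top = ω ; below = top ∷ below ; length-below = ≡.cong suc length-below ; top∈τ = ω∈τ
              ; roots = bω≈0 ∷ roots ; below-top = below-ω ; distinct = All.map fresh below-ω ∷ distinct })
            (no bω≉0) → ω∉U (poles-coprime ω ω∈τ
              (isPole-at-root a b h≃Δ (All.head roots) (no-common-root top (All.head roots)) ωᵖ≈top bω≉0))
          where open Chain c

        chain : ∀ k → ¬ ¬ Chain k
        chain zero = chain-start
        chain (suc k) none = chain k (λ c → chain-extend c none)

        contradiction : ⊥
        contradiction = chain (length b) λ c → let open Chain c in
          too-many-roots distinct b (1# ∷ [])
            (ℕ.≤-reflexive (≡.trans (ℕ.+-comm (length b) 1) (≡.cong suc (≡.sym length-below))))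
            (All.map (λ bx≈0 notRoot → notRoot (inj₁ bx≈0)) roots)
            b≉0 (λ 1≈0 → 1≉0 (1≈0 0))

      no-representation : ∀ β → (∀ ω → InTree β ω → IsPole h ω → CoprimeRootOfUnity ω) →
                          ∀ {α₀} → InTree β α₀ → IsPole h α₀ →
                          ∀ a b → NonZeroPoly b → Represents a b → ⊥
      no-representation β poles-coprime {α₀} α₀∈τ pole a b = go a b (<-wellFounded (length b))
        where
        go : ∀ a b → Acc _<_ (length b) → NonZeroPoly b → Represents a b → ⊥
        go a b (acc shorter) b≉0 h≃Δ =
          RootChain.contradiction β a b h≃Δ b≉0 no-common-root poles-coprime initial-root
          where
          no-common-root : ∀ γ → eval b γ ≈ 0# → ¬ eval a γ ≈ 0#
          no-common-root γ bγ≈0 aγ≈0 = represents-cancel-common-root a b γ b≉0 h≃Δ aγ≈0 bγ≈0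
            (go (quot γ a) (quot γ b) (shorter (length-quot-< γ b b≉0))
                (λ quot≈0 → b≉0 (zeroPoly-quot γ b bγ≈0 quot≈0)))
          initial-root : ¬ ¬ (∃[ γ ] (InTree β γ × eval b γ ≈ 0#))
          initial-root = ¬¬-map
            (Sum.[ (λ bα₀≈0 → α₀ , α₀∈τ , bα₀≈0) , (λ bα₀ᵖ≈0 → pow α₀ p , inTree-pow α₀∈τ , bα₀ᵖ≈0) ])
            (root-near-pole a b h≃Δ pole)

  not-summable : (f : RatFun) → NonZeroPoly (den f) → (λ' : ℤ) → (β : Carrier) →
                 InSupp f β → HtZero f β → (fτ : RatFun) → IsTauComponent f β fτ → ¬ MahlerSummable λ' fτ
  not-summable f f≉0 λ' β (α₀ , α₀∈τ , poleF) ht h (h≉0 , _ , _ , regular) (s , s≈pᵏ , g , g≉0 , h≃Δg) =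
    no-representation β poles-coprime α₀∈τ poleH (num g) (den g) g≉0 h≃Δg
    where
    open Delta s (powλ-nonZero λ' s≈pᵏ)
    open Representation h h≉0
    poleH : IsPole h α₀
    poleH = isPole-subtrahend f h f≉0 h≉0 poleF (regular α₀ α₀∈τ)
    poles-coprime : ∀ ω → InTree β ω → IsPole h ω → CoprimeRootOfUnity ω
    poles-coprime ω ω∈τ poleHω =
      height-zero⇒coprimeRoot (ht ω ω∈τ (isPole-minuend f h f≉0 h≉0 poleHω (regular ω ω∈τ)))

lemma5p14 : ∀ {c ℓ : Level} (K : ACField c ℓ) (p : ℕ) → 2 ≤ p →
    let open ACField K
        open Theory K p
    in (f : RatFun) → NonZeroPoly (den f) → (λ' : ℤ) →
       (β : Carrier) → ¬ (β ≈ 0#) →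
       InSupp f β → InTPlus β → HtZero f β →
       (fτ : RatFun) → IsTauComponent f β fτ →
       ¬ MahlerSummable λ' fτ
lemma5p14 K (suc (suc q)) (ℕ.s≤s (ℕ.s≤s ℕ.z≤n)) f f≉0 λ' β _ supp _ ht =
  Mahler.not-summable K q f f≉0 λ' β supp ht
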